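{- Let $\ell\in\Sigma^n$ with $n>1$ be border-free. If $\ell$ is not a Lyndon word, then for every $\ell'\in\Sigma^+$ the string $\ell\ell'$ is not a Lyndon word.
   Context: $\Sigma$ is a finite totally ordered alphabet and $\Sigma^+$ the set of nonempty strings over it. A Lyndon word is a nonempty string strictly lexicographically smaller than each of its nonempty proper suffixes. A border of $w$ is a string that is both a prefix and suffix of $w$ and differs from $w$; $w$ is border-free if its only border is empty. -}

module Defs where

open import Data.Nat using (ℕ; suc; _<_)
open import Data.Fin using (Fin)
import Data.Fin as F
open import Data.List using (List; []; _∷_; _++_; length)
open import Data.List.Relation.Binary.Lex.Strict using (Lex-<)
open import Data.Product using (Σ; _×_; ∃; ∃-syntax)
open import Relation.Binary.PropositionalEquality using (_≡_; _≢_)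

-- The alphabet: a finite totally ordered set of size k, represented as Fin k
-- with its usual strict order (every finite total order is isomorphic to one).
Alphabet : ℕ → Set
Alphabet k = Fin k

Str : ℕ → Set
Str k = List (Fin k)

NonEmpty : ∀ {k} → Str k → Set
NonEmpty w = 0 < length w

-- strict lexicographic order on strings (a proper prefix is smaller)
_≺_ : ∀ {k} → Str k → Str k → Set
_≺_ = Lex-< _≡_ F._<_

ProperSuffix : ∀ {k} → Str k → Str k → Set
ProperSuffix s w = NonEmpty s × ∃[ u ] (NonEmpty u × w ≡ u ++ s)

Lyndon : ∀ {k} → Str k → Set
Lyndon w = NonEmpty w × (∀ s → ProperSuffix s w → w ≺ s)

Border : ∀ {k} → Str k → Str k → Set
Border b w = (∃[ u ] w ≡ b ++ u) × (∃[ v ] w ≡ v ++ b) × b ≢ w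

BorderFree : ∀ {k} → Str k → Set
BorderFree w = ∀ b → Border b w → b ≡ []

module Submission where

-- Suppose ℓ is border-free and ℓℓ′ is Lyndon; we show ℓ is Lyndon,
-- which is the contrapositive of the theorem.  Let s be a nonempty proper
-- suffix of ℓ and compare s with ℓ letter by letter.  One of three
-- things happens:
--   * ℓ ≺ s, which is what we want;
--   * s is a prefix of ℓ, so s is a nonempty border of ℓ — impossible;
--   * s and ℓ first differ at a position where s is smaller, and then this
--     difference survives appending ℓ′: sℓ′ ≺ ℓℓ′.  But sℓ′ is a proper
--     suffix of ℓℓ′, contradicting that ℓℓ′ is Lyndon (≺ is asymmetric).

open import Defs
open import Data.Nat using (ℕ; _<_; s≤s; z≤n)
open import Data.Nat.Properties using (<-trans)
open import Data.List using ([]; _∷_; length; _++_)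
open import Data.List.Properties using (++-assoc; ++-identityˡ-unique)
open import Data.List.Relation.Binary.Lex.Core using (halt; this; next)
open import Data.List.Relation.Binary.Lex.Strict using (<-asymmetric)
open import Data.Fin.Properties using (<-cmp; <-asym; <-resp₂-≡)
open import Data.Product using (_,_; ∃)
open import Data.Sum using (_⊎_; inj₁; inj₂)
open import Data.Empty using (⊥-elim)
open import Relation.Binary using (tri<; tri≈; tri>)
open import Relation.Binary.PropositionalEquality using (_≡_; _≢_; refl; sym; cong)
open import Relation.Nullary using (¬_)

≺-asym : ∀ {k} {a b : Str k} → a ≺ b → ¬ b ≺ a
≺-asym = <-asymmetric sym <-resp₂-≡ <-asym

compare-or-prefix : ∀ {k} (s l t : Str k) →
                    l ≺ s ⊎ (∃ λ u → l ≡ s ++ u) ⊎ (s ++ t) ≺ (l ++ t)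
compare-or-prefix []       l        t = inj₂ (inj₁ (l , refl))
compare-or-prefix (x ∷ xs) []       t = inj₁ halt
compare-or-prefix (x ∷ xs) (y ∷ ys) t with <-cmp x y
... | tri< x<y _ _ = inj₂ (inj₂ (this x<y))
... | tri> _ _ y<x = inj₁ (this y<x)
... | tri≈ _ refl _ with compare-or-prefix xs ys t
...   | inj₁ ys≺xs                = inj₁ (next refl ys≺xs)
...   | inj₂ (inj₁ (u , ys≡xs++u)) = inj₂ (inj₁ (u , cong (x ∷_) ys≡xs++u))
...   | inj₂ (inj₂ xs++t≺ys++t)   = inj₂ (inj₂ (next refl xs++t≺ys++t))

proper-suffix-≢ : ∀ {k} {s w : Str k} → ProperSuffix s w → s ≢ w
proper-suffix-≢ (_ , x ∷ u , _ , w≡xu++s) refl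
  with ++-identityˡ-unique (x ∷ u) w≡xu++s
... | ()

proper-suffix-++ : ∀ {k} {s w : Str k} (t : Str k) →
                   ProperSuffix s w → ProperSuffix (s ++ t) (w ++ t)
proper-suffix-++ {s = x ∷ s′} t (_ , u , u-ne , refl) =
  s≤s z≤n , u , u-ne , ++-assoc u (x ∷ s′) t

suffix-not-prefix : ∀ {k} {s w : Str k} → BorderFree w → ProperSuffix s w →
                    ¬ (∃ λ u → w ≡ s ++ u)
suffix-not-prefix bf sfx@(_ , u , _ , w≡u++s) prefix
  with bf _ (prefix , (u , w≡u++s) , proper-suffix-≢ sfx)
suffix-not-prefix bf (() , _) prefix | refl

borderfree-prefix-of-lyndon : ∀ {k} {w : Str k} (t : Str k) →
                              BorderFree w → NonEmpty w → Lyndon (w ++ t) → Lyndon w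
borderfree-prefix-of-lyndon {w = w} t bf w-ne (_ , wt-below-suffixes) =
  w-ne , w-below-suffixes
  where
  w-below-suffixes : ∀ s → ProperSuffix s w → w ≺ s
  w-below-suffixes s sfx with compare-or-prefix s w t
  ... | inj₁ w≺s           = w≺s
  ... | inj₂ (inj₁ prefix) = ⊥-elim (suffix-not-prefix bf sfx prefix)
  ... | inj₂ (inj₂ st≺wt)  =
    ⊥-elim (≺-asym st≺wt (wt-below-suffixes (s ++ t) (proper-suffix-++ t sfx)))

lemma3 : (k : ℕ) (ℓ : Str k) → 1 < length ℓ → BorderFree ℓ → ¬ Lyndon ℓ →
         (ℓ′ : Str k) → NonEmpty ℓ′ → ¬ Lyndon (ℓ ++ ℓ′)
lemma3 k ℓ 1<|ℓ| bf not-lyndon ℓ′ _ ℓℓ′-lyndon =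
  not-lyndon (borderfree-prefix-of-lyndon ℓ′ bf ℓ-ne ℓℓ′-lyndon)
  where
  ℓ-ne : NonEmpty ℓ
  ℓ-ne = <-trans (s≤s z≤n) 1<|ℓ|
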